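{- If $\mathcal Q=(W,\preccurlyeq,S,\ell)$ is a quasimodel, then $(\widehat W,\widehat\preccurlyeq,\widehat S)$ is a dynamic poset; that is, $\widehat\preccurlyeq$ is a partial order on $\widehat W$, $\widehat S$ is a function from $\widehat W$ to $\widehat W$, and $\alpha\mathrel{\widehat\preccurlyeq}\beta$ implies $\widehat S(\alpha)\mathrel{\widehat\preccurlyeq}\widehat S(\beta)$.
   Context: $\mathcal L_\Diamond$ is the language built from a countable set of propositional variables by $\varphi ::= \bot \mid p \mid \varphi\wedge\varphi \mid \varphi\vee\varphi\mid \varphi\to\varphi\mid \circ\varphi\mid\Diamond\varphi$. A (two-sided) type is a pair $\Phi=(\Phi^-;\Phi^+)$ of finite subsets of $\mathcal L_\Diamond$ such that: $\Phi^-\cap\Phi^+=\varnothing$; $\bot\notin\Phi^+$; if $\varphi\wedge\psi\in\Phi^+$ then $\varphi,\psi\in\Phi^+$; if $\varphi\wedge\psi\in\Phi^-$ then $\varphi\in\Phi^-$ or $\psi\in\Phi^-$; if $\varphi\vee\psi\in\Phi^+$ then $\varphi\in\Phi^+$ or $\psi\in\Phi^+$; if $\varphi\vee\psi\in\Phi^-$ then $\varphi,\psi\in\Phi^-$; if $\varphi\to\psi\in\Phi^+$ then $\varphi\in\Phi^-$ or $\psi\in\Phi^+$; if $\Diamond\varphi\in\Phi^-$ then $\varphi\in\Phi^-$. $\Phi\preccurlyeq_T\Psi$ iff $\Psi^-\subseteq\Phi^-$ and $\Phi^+\subseteq\Psi^+$; $\Phi\sqsubseteq_T\Psi$ iff $\Phi^-=\Psi^-$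 and $\Phi^+\subseteq\Psi^+$. $\Phi\mathrel{S_T}\Psi$ iff for all $\varphi$: if $\circ\varphi\in\Phi^+$ then $\varphi\in\Psi^+$; if $\circ\varphi\in\Phi^-$ then $\varphi\in\Psi^-$; if $\Diamond\varphi\in\Phi^+$ then $\varphi\in\Phi^+$ or $\Diamond\varphi\in\Psi^+$; if $\Diamond\varphi\in\Phi^-$ then $\Diamond\varphi\in\Psi^-$. A labelled frame is $(W,\preccurlyeq,\ell)$ with $\preccurlyeq$ a partial order and $\ell(w)=(\ell^-(w);\ell^+(w))$ a type for each $w$, such that $w\preccurlyeq v$ implies $\ell(w)\preccurlyeq_T\ell(v)$ and whenever $\varphi\to\psi\in\ell^-(w)$ there is $v\succcurlyeq w$ with $\varphi\in\ell^+(v)$, $\psi\in\ell^-(v)$. A quasimodel is $(W,\preccurlyeq,S,\ell)$ with $(W,\preccurlyeq,\ell)$ a labelled frame and $S\subseteq W\times W$ serial, forward-confluent (if $w\preccurlyeq w'$ and $w\mathrel S v$ there is $v'\succcurlyeq v$ with $w'\mathrel S v'$), sensible ($w\mathrel S x$ implies $\ell(w)\mathrel{S_T}\ell(x)$) and $\omega$-sensible (if $\Diamond\varphi\in\ell^+(w)$ there are $n\ge0$, $v$ with $w\mathrel S^n v$, $\varphi\in\ell^+(v)$). A typed path on $\mathcal Q$ is a sequence $((w_i,\Phi_i))_{i<n}$ with $w_i\mathrel S w_{i+1}$ and $\Phi_i\mathrel{S_T}\Phi_{i+1}$ for $i<n-1$, and $\Phi_i$ a type with $\Phi_i\sqsubseteq_T\ell(w_i)$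 for $i<n$; it is terminal if $n\ge1$ and $\Phi^+_{n-1}=\varnothing$. $\widehat W$ is the set of terminal typed paths together with the empty path $\epsilon$. For $\alpha=((w_i,\Phi_i))_{i<n}$, $\beta=((v_i,\Psi_i))_{i<m}$ in $\widehat W$, $\alpha\mathrel{\widehat\preccurlyeq}\beta$ iff $n\le m$ and $w_i\preccurlyeq v_i$, $\Phi_i\preccurlyeq_T\Psi_i$ for all $i<n$. $\widehat S(((w_i,\Phi_i))_{i<n})=((w_{i+1},\Phi_{i+1}))_{i<n-1}$ (delete the first entry), with $\widehat S(\epsilon)=\epsilon$. A dynamic poset is a triple consisting of a set, a partial order on it, and a monotone self-map. -}

module Defs where

open import Level using (Level; _⊔_) renaming (suc to lsuc)
open import Data.Nat using (ℕ; zero; suc)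
open import Data.List using (List; []; _∷_)
open import Data.List.Membership.Propositional using (_∈_)
open import Data.List.Relation.Unary.All using (All)
open import Data.Product using (Σ; ∃; ∃-syntax; _×_; _,_; proj₁; proj₂)
open import Data.Sum using (_⊎_)
open import Data.Empty using (⊥)
open import Relation.Nullary using (¬_)
open import Relation.Binary.PropositionalEquality using (_≡_)
open import Relation.Binary.Structures using (IsPartialOrder)

infixr 6 _∧'_
infixr 5 _∨'_
infixr 4 _⇒_

data Form : Set where
  ⊥'   : Form
  var  : ℕ → Form
  _∧'_ : Form → Form → Form
  _∨'_ : Form → Form → Form
  _⇒_  : Form → Form → Form
  ○    : Form → Form
  ◇    : Form → Form

-- Finite sets of formulas are represented by lists (membership = ∈).
-- A pair (Φ⁻ ; Φ⁺):

TPair : Set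
TPair = List Form × List Form

neg pos : TPair → List Form
neg = proj₁
pos = proj₂

_⊆_ : List Form → List Form → Set
xs ⊆ ys = ∀ {φ} → φ ∈ xs → φ ∈ ys

_≐_ : List Form → List Form → Set
xs ≐ ys = xs ⊆ ys × ys ⊆ xs

record IsType (Φ : TPair) : Set where
  field
    disjoint : ∀ {φ} → φ ∈ neg Φ → φ ∈ pos Φ → ⊥
    noBot    : ¬ (⊥' ∈ pos Φ)
    ∧⁺ : ∀ {φ ψ} → (φ ∧' ψ) ∈ pos Φ → φ ∈ pos Φ × ψ ∈ pos Φ
    ∧⁻ : ∀ {φ ψ} → (φ ∧' ψ) ∈ neg Φ → φ ∈ neg Φ ⊎ ψ ∈ neg Φ
    ∨⁺ : ∀ {φ ψ} → (φ ∨' ψ) ∈ pos Φ → φ ∈ pos Φ ⊎ ψ ∈ pos Φ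
    ∨⁻ : ∀ {φ ψ} → (φ ∨' ψ) ∈ neg Φ → φ ∈ neg Φ × ψ ∈ neg Φ
    ⇒⁺ : ∀ {φ ψ} → (φ ⇒ ψ) ∈ pos Φ → φ ∈ neg Φ ⊎ ψ ∈ pos Φ
    ◇⁻ : ∀ {φ} → ◇ φ ∈ neg Φ → φ ∈ neg Φ

_≼T_ : TPair → TPair → Set
Φ ≼T Ψ = neg Ψ ⊆ neg Φ × pos Φ ⊆ pos Ψ

_⊑T_ : TPair → TPair → Set
Φ ⊑T Ψ = neg Φ ≐ neg Ψ × pos Φ ⊆ pos Ψ

_≈T_ : TPair → TPair → Set
Φ ≈T Ψ = neg Φ ≐ neg Ψ × pos Φ ≐ pos Ψ

record _S[T]_ (Φ Ψ : TPair) : Set where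
  field
    ○⁺ : ∀ {φ} → ○ φ ∈ pos Φ → φ ∈ pos Ψ
    ○⁻ : ∀ {φ} → ○ φ ∈ neg Φ → φ ∈ neg Ψ
    ◇⁺ : ∀ {φ} → ◇ φ ∈ pos Φ → φ ∈ pos Φ ⊎ ◇ φ ∈ pos Ψ
    ◇⁻ : ∀ {φ} → ◇ φ ∈ neg Φ → ◇ φ ∈ neg Ψ

_^[_] : ∀ {a} {W : Set a} → (W → W → Set a) → ℕ → W → W → Set a
(S ^[ zero ]) w v = w ≡ v
(S ^[ suc n ]) w v = ∃[ u ] (S w u × (S ^[ n ]) u v)

record Quasimodel (a : Level) : Set (lsuc a) where
  field
    W   : Set a
    _≼_ : W → W → Set a
    S   : W → W → Set a
    ℓ   : W → TPair
    ≼-po       : IsPartialOrder _≡_ _≼_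
    ℓ-type     : ∀ w → IsType (ℓ w)
    ℓ-mono     : ∀ {w v} → w ≼ v → ℓ w ≼T ℓ v
    ℓ-⇒⁻       : ∀ {w φ ψ} → (φ ⇒ ψ) ∈ neg (ℓ w) →
                 ∃[ v ] (w ≼ v × φ ∈ pos (ℓ v) × ψ ∈ neg (ℓ v))
    serial     : ∀ w → ∃[ v ] S w v
    confluent  : ∀ {w w' v} → w ≼ w' → S w v → ∃[ v' ] (v ≼ v' × S w' v')
    sensible   : ∀ {w x} → S w x → ℓ w S[T] ℓ x
    ω-sensible : ∀ {w φ} → ◇ φ ∈ pos (ℓ w) →
                 ∃[ n ] ∃[ v ] ((S ^[ n ]) w v × φ ∈ pos (ℓ v))

module _ {a : Level} (Q : Quasimodel a) where
  open Quasimodel Q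

  Path : Set a
  Path = List (W × TPair)

  EntryOK : W × TPair → Set
  EntryOK (w , Φ) = IsType Φ × Φ ⊑T ℓ w

  data Linked : Path → Set a where
    []ᴸ  : Linked []
    [_]ᴸ : ∀ x → Linked (x ∷ [])
    _∷ᴸ_ : ∀ {w Φ v Ψ α} → S w v × Φ S[T] Ψ →
           Linked ((v , Ψ) ∷ α) → Linked ((w , Φ) ∷ (v , Ψ) ∷ α)

  TypedPath : Path → Set a
  TypedPath α = Linked α × All EntryOK α

  data Terminal : Path → Set a where
    last : ∀ {w Φ} → pos Φ ≡ [] → Terminal ((w , Φ) ∷ [])
    more : ∀ {x y α} → Terminal (y ∷ α) → Terminal (x ∷ y ∷ α)

  InŴ : Path → Set a
  InŴ α = α ≡ [] ⊎ (TypedPath α × Terminal α)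

  Ŵ : Set a
  Ŵ = Σ Path InŴ

  -- α ≼̂ β : length α ≤ length β and pointwise w_i ≼ v_i, Φ_i ≼_T Ψ_i
  data _≼̂ₚ_ : Path → Path → Set a where
    []≼ : ∀ {β} → [] ≼̂ₚ β
    _∷≼_ : ∀ {w Φ v Ψ α β} → w ≼ v × Φ ≼T Ψ → α ≼̂ₚ β →
           ((w , Φ) ∷ α) ≼̂ₚ ((v , Ψ) ∷ β)

  data _≈̂ₚ_ : Path → Path → Set a where
    []≈ : [] ≈̂ₚ []
    _∷≈_ : ∀ {w Φ v Ψ α β} → w ≡ v × Φ ≈T Ψ → α ≈̂ₚ β →
           ((w , Φ) ∷ α) ≈̂ₚ ((v , Ψ) ∷ β)

  Ŝₚ : Path → Path
  Ŝₚ []      = []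
  Ŝₚ (_ ∷ α) = α

  _≼̂_ : Ŵ → Ŵ → Set a
  α ≼̂ β = proj₁ α ≼̂ₚ proj₁ β

  _≈̂_ : Ŵ → Ŵ → Set a
  α ≈̂ β = proj₁ α ≈̂ₚ proj₁ β

  IsDynamicPosetŴ : Set a
  IsDynamicPosetŴ =
    IsPartialOrder _≈̂_ _≼̂_ ×
    Σ ((α : Ŵ) → InŴ (Ŝₚ (proj₁ α))) (λ Ŝ-closed →
      ∀ (α β : Ŵ) → α ≼̂ β →
        (Ŝₚ (proj₁ α) , Ŝ-closed α) ≼̂ (Ŝₚ (proj₁ β) , Ŝ-closed β))

module Submission where

open import Defs
open import Level using (Level)
open import Function using (id; _∘_)
open import Data.List using ([]; _∷_)
open import Data.List.Relation.Unary.All using (_∷_)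
open import Data.Product using (_,_; proj₁)
open import Data.Sum using (inj₁; inj₂)
open import Relation.Binary.PropositionalEquality as ≡ using (_≡_)
open import Relation.Binary.Structures using (IsPartialOrder)

≐-refl : ∀ {xs} → xs ≐ xs
≐-refl = id , id

≐-sym : ∀ {xs ys} → xs ≐ ys → ys ≐ xs
≐-sym (xs⊆ys , ys⊆xs) = ys⊆xs , xs⊆ys

≐-trans : ∀ {xs ys zs} → xs ≐ ys → ys ≐ zs → xs ≐ zs
≐-trans (xs⊆ys , ys⊆xs) (ys⊆zs , zs⊆ys) = ys⊆zs ∘ xs⊆ys , ys⊆xs ∘ zs⊆ys

≈T-refl : ∀ {Φ} → Φ ≈T Φ
≈T-refl = ≐-refl , ≐-refl

≈T-sym : ∀ {Φ Ψ} → Φ ≈T Ψ → Ψ ≈T Φ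
≈T-sym (n , p) = ≐-sym n , ≐-sym p

≈T-trans : ∀ {Φ Ψ Χ} → Φ ≈T Ψ → Ψ ≈T Χ → Φ ≈T Χ
≈T-trans (n , p) (n' , p') = ≐-trans n n' , ≐-trans p p'

≈T⇒≼T : ∀ {Φ Ψ} → Φ ≈T Ψ → Φ ≼T Ψ
≈T⇒≼T ((_ , negΨ⊆negΦ) , (posΦ⊆posΨ , _)) = negΨ⊆negΦ , posΦ⊆posΨ

≼T-trans : ∀ {Φ Ψ Χ} → Φ ≼T Ψ → Ψ ≼T Χ → Φ ≼T Χ
≼T-trans (n , p) (n' , p') = n ∘ n' , p' ∘ p

≼T-antisym : ∀ {Φ Ψ} → Φ ≼T Ψ → Ψ ≼T Φ → Φ ≈T Ψ
≼T-antisym (negΨ⊆negΦ , posΦ⊆posΨ) (negΦ⊆negΨ , posΨ⊆posΦ) =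
  (negΦ⊆negΨ , negΨ⊆negΦ) , (posΦ⊆posΨ , posΨ⊆posΦ)

module Paths {a : Level} (Q : Quasimodel a) where
  open Quasimodel Q
  private module ≼ = IsPartialOrder ≼-po

  ≈̂ₚ-refl : ∀ α → _≈̂ₚ_ Q α α
  ≈̂ₚ-refl []      = []≈
  ≈̂ₚ-refl (_ ∷ α) = (≡.refl , ≈T-refl) ∷≈ ≈̂ₚ-refl α

  ≈̂ₚ-sym : ∀ {α β} → _≈̂ₚ_ Q α β → _≈̂ₚ_ Q β α
  ≈̂ₚ-sym []≈                = []≈
  ≈̂ₚ-sym ((w≡v , Φ≈Ψ) ∷≈ r) = (≡.sym w≡v , ≈T-sym Φ≈Ψ) ∷≈ ≈̂ₚ-sym r

  ≈̂ₚ-trans : ∀ {α β γ} → _≈̂ₚ_ Q α β → _≈̂ₚ_ Q β γ → _≈̂ₚ_ Q α γ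
  ≈̂ₚ-trans []≈ []≈ = []≈
  ≈̂ₚ-trans ((w≡v , Φ≈Ψ) ∷≈ r) ((v≡u , Ψ≈Χ) ∷≈ r') =
    (≡.trans w≡v v≡u , ≈T-trans Φ≈Ψ Ψ≈Χ) ∷≈ ≈̂ₚ-trans r r'

  ≈̂ₚ⇒≼̂ₚ : ∀ {α β} → _≈̂ₚ_ Q α β → _≼̂ₚ_ Q α β
  ≈̂ₚ⇒≼̂ₚ []≈                = []≼
  ≈̂ₚ⇒≼̂ₚ ((w≡v , Φ≈Ψ) ∷≈ r) = (≼.reflexive w≡v , ≈T⇒≼T Φ≈Ψ) ∷≼ ≈̂ₚ⇒≼̂ₚ r

  ≼̂ₚ-trans : ∀ {α β γ} → _≼̂ₚ_ Q α β → _≼̂ₚ_ Q β γ → _≼̂ₚ_ Q α γ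
  ≼̂ₚ-trans []≼ _ = []≼
  ≼̂ₚ-trans ((w≼v , Φ≼Ψ) ∷≼ r) ((v≼u , Ψ≼Χ) ∷≼ r') =
    (≼.trans w≼v v≼u , ≼T-trans Φ≼Ψ Ψ≼Χ) ∷≼ ≼̂ₚ-trans r r'

  -- Antisymmetry also forces equal lengths: a nonempty path is never ≼̂ₚ [].
  ≼̂ₚ-antisym : ∀ {α β} → _≼̂ₚ_ Q α β → _≼̂ₚ_ Q β α → _≈̂ₚ_ Q α β
  ≼̂ₚ-antisym []≼ []≼ = []≈
  ≼̂ₚ-antisym ((w≼v , Φ≼Ψ) ∷≼ r) ((v≼w , Ψ≼Φ) ∷≼ r') =
    (≼.antisym w≼v v≼w , ≼T-antisym Φ≼Ψ Ψ≼Φ) ∷≈ ≼̂ₚ-antisym r r'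

  ≼̂-isPartialOrder : IsPartialOrder (_≈̂_ Q) (_≼̂_ Q)
  ≼̂-isPartialOrder = record
    { isPreorder = record
        { isEquivalence = record
            { refl  = λ {α} → ≈̂ₚ-refl (proj₁ α)
            ; sym   = ≈̂ₚ-sym
            ; trans = ≈̂ₚ-trans
            }
        ; reflexive = ≈̂ₚ⇒≼̂ₚ
        ; trans     = ≼̂ₚ-trans
        }
    ; antisym = ≼̂ₚ-antisym
    }

  -- Deleting the first entry of a path with at least two entries keeps it
  -- typed (S-links and entry conditions are inherited) and terminal (the
  -- last entry is unchanged).
  typed-tail : ∀ {x y α} → TypedPath Q (x ∷ y ∷ α) → TypedPath Q (y ∷ α)
  typed-tail (_ ∷ᴸ linked , _ ∷ entriesOK) = linked , entriesOK

  terminal-tail : ∀ {x y α} → Terminal Q (x ∷ y ∷ α) → Terminal Q (y ∷ α)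
  terminal-tail (more t) = t

  Ŝ-closed : (α : Ŵ Q) → InŴ Q (Ŝₚ Q (proj₁ α))
  Ŝ-closed ([] , _)                    = inj₁ ≡.refl
  Ŝ-closed (_ ∷ [] , _)                = inj₁ ≡.refl
  Ŝ-closed (_ ∷ _ ∷ _ , inj₁ ())
  Ŝ-closed (_ ∷ _ ∷ _ , inj₂ (tp , t)) = inj₂ (typed-tail tp , terminal-tail t)

  Ŝₚ-mono : ∀ {α β} → _≼̂ₚ_ Q α β → _≼̂ₚ_ Q (Ŝₚ Q α) (Ŝₚ Q β)
  Ŝₚ-mono []≼      = []≼
  Ŝₚ-mono (_ ∷≼ r) = r

lemma8p4 : ∀ {a : Level} (Q : Quasimodel a) → IsDynamicPosetŴ Q
lemma8p4 Q = ≼̂-isPartialOrder , Ŝ-closed , λ _ _ → Ŝₚ-mono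
  where open Paths Q
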